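{- Let $X$ be a two-ended, connected, locally finite, vertex-transitive graph with a unique hamiltonian circle $C$, and write $C=P_1\cup P_2$, where $P_1,P_2$ are vertex-disjoint two-way-infinite paths each of which converges to one end of $X$ in one direction and to the other end in the other direction. Then there exist an automorphism $g_2$ of $X$ and a labelling of the vertices of $X$ such that $P_1=\cdots - x_{ -1}-x_0-x_1-\cdots$, $P_2=\cdots-y_{ -1}-y_0-y_1-\cdots$, and $g_2(x_i)=x_{i+2}$ and $g_2(y_i)=y_{i+2}$ for all $i\in\mathbb{Z}$.
   Context: A graph is vertex-transitive if its automorphism group acts transitively on its vertices. For a connected locally finite graph $X$, the number of ends is the smallest $k\in\mathbb{N}\cup\{\infty\}$ such that for every finite $K\subseteq V(X)$, $X\smallsetminus K$ has at most $k$ infinite components; the Freudenthal compactification $|X|$ adds one point per end. A hamiltonian circle is a subspace of $|X|$ homeomorphic to $S^1$ containing all vertices, identified with the spanning 2-regular subgraph it meets $X$ in. When $X$ has exactly two ends, a 2-factor is a hamiltonian circle iff it is a vertex-disjoint union of two two-way-infinite paths each joining the two ends, as in the claim. -}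

module Defs where

open import Level using (0ℓ)
open import Data.Nat using (ℕ; suc)
open import Data.Fin using (Fin)
open import Data.Integer using (ℤ; +_; _+_; _-_; -_)
open import Data.List using (List; [])
open import Data.List.Membership.Propositional using (_∈_; _∉_)
open import Data.Product using (Σ; ∃; ∃-syntax; _×_; _,_)
open import Data.Sum using (_⊎_)
open import Relation.Nullary using (¬_)
open import Relation.Binary.PropositionalEquality using (_≡_; _≢_)
open import Function.Bundles using (_⇔_)

record Graph : Set₁ where
  field
    V    : Set
    _~_  : V → V → Set
    ~-sym   : ∀ {u v} → u ~ v → v ~ u
    ~-irrefl : ∀ {u} → ¬ (u ~ u)

module GraphNotions (X : Graph) where
  open Graph X

  data Reach (K : List V) : V → V → Set where
    here : ∀ {u} → u ∉ K → Reach K u u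
    step : ∀ {u w z} → u ∉ K → u ~ w → Reach K w z → Reach K u z

  Connected : Set
  Connected = ∀ u v → Reach [] u v

  LocallyFinite : Set
  LocallyFinite = ∀ v → ∃[ l ] (∀ w → v ~ w → w ∈ l)

  record Aut : Set where
    field
      to       : V → V
      from     : V → V
      to-from  : ∀ v → to (from v) ≡ v
      from-to  : ∀ v → from (to v) ≡ v
      adj      : ∀ u v → (u ~ v) ⇔ (to u ~ to v)

  VertexTransitive : Set
  VertexTransitive = ∀ u v → Σ Aut (λ g → Aut.to g u ≡ v)

  -- v lies in an infinite component of X ∖ K
  InInfComp : List V → V → Set
  InInfComp K v = v ∉ K × (∀ (L : List V) → ∃[ w ] (w ∉ L × Reach K v w))

  -- for every finite K, X ∖ K has at most k infinite components
  AtMostEnds : ℕ → Set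
  AtMostEnds k = ∀ (K : List V) (f : Fin (suc k) → V) →
    (∀ i → InInfComp K (f i)) →
    ∃[ i ] ∃[ j ] (i ≢ j × Reach K (f i) (f j))

  TwoEnded : Set
  TwoEnded = AtMostEnds 2 × ¬ AtMostEnds 1

  IsRay : (ℕ → V) → Set
  IsRay r = (∀ m n → r m ≡ r n → m ≡ n) × (∀ n → r n ~ r (suc n))

  -- two rays converge to the same end: no finite K separates their tails
  SameEnd : (ℕ → V) → (ℕ → V) → Set
  SameEnd r s = ∀ (K : List V) → ∃[ m ] ∃[ n ]
    ((∀ k → r (k Data.Nat.+ m) ∉ K) × (∀ k → s (k Data.Nat.+ n) ∉ K)
      × Reach K (r m) (s n))

  IsDoubleRay : (ℤ → V) → Set
  IsDoubleRay d = (∀ i j → d i ≡ d j → i ≡ j) × (∀ i → d i ~ d (i + + 1))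

  forward backward : (ℤ → V) → (ℕ → V)
  forward d n = d (+ n)
  backward d n = d (- (+ n))

  JoinsTheEnds : (ℤ → V) → Set
  JoinsTheEnds d = ¬ SameEnd (forward d) (backward d)

  EdgeOf : (ℤ → V) → V → V → Set
  EdgeOf d u v = ∃[ i ] ((u ≡ d i × v ≡ d (i + + 1)) ⊎ (v ≡ d i × u ≡ d (i + + 1)))

  -- The edge set H is the hamiltonian circle P₁ ∪ P₂ of the two-ended graph:
  -- P₁ = d₁, P₂ = d₂ are vertex-disjoint double rays covering V, each joining
  -- the two ends, and H consists exactly of their edges.
  IsHamDecomp : (V → V → Set) → (ℤ → V) → (ℤ → V) → Set
  IsHamDecomp H d₁ d₂ =
    IsDoubleRay d₁ × IsDoubleRay d₂ ×
    (∀ i j → d₁ i ≢ d₂ j) ×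
    (∀ v → (∃[ i ] v ≡ d₁ i) ⊎ (∃[ i ] v ≡ d₂ i)) ×
    JoinsTheEnds d₁ × JoinsTheEnds d₂ ×
    (∀ u v → H u v ⇔ (EdgeOf d₁ u v ⊎ EdgeOf d₂ u v))

  HamCircle : (V → V → Set) → Set
  HamCircle H = ∃[ d₁ ] ∃[ d₂ ] IsHamDecomp H d₁ d₂

  UniqueHamCircle : (V → V → Set) → Set₁
  UniqueHamCircle H = HamCircle H ×
    (∀ H′ → HamCircle H′ → ∀ u v → H u v ⇔ H′ u v)

  Relabels : (ℤ → V) → (ℤ → V) → Set
  Relabels d x = ∃[ s ] ((∀ i → x i ≡ d (s + i)) ⊎ (∀ i → x i ≡ d (s - i)))

-- Every automorphism maps the unique hamiltonian circle C = P₁ ∪ P₂ to itself, hence maps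
-- each Pᵢ onto some Pⱼ, either shifting or flipping the indices. Vertex transitivity yields
-- an automorphism f shifting P₁ by 2; f cannot flip P₂ (else f² would fix P₂ pointwise and
-- shift P₁ by 4, so a vertex of P₂ adjacent to P₁ would have infinitely many neighbours), so
-- f shifts P₂ by some t. An automorphism fixing one path while shifting an adjacent one cannot
-- shift it at all, by local finiteness; applied to suitable powers of two automorphisms this
-- makes the ratio of the shifts on P₁ and P₂ the same for all automorphisms. Comparing f with
-- its conjugate by an automorphism exchanging P₁ and P₂ gives t² = 4, so t = ±2.
module Submission where

open import Defs
open import Data.Integer using (ℤ; +_; _+_)
open import Data.Product using (Σ; ∃-syntax; _×_)
open import Relation.Binary.PropositionalEquality using (_≡_)

open import Data.Nat as ℕ using (ℕ; zero; suc; s≤s)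
import Data.Nat.Properties as ℕ
open import Data.Integer using (-_; _-_; _*_; -[1+_]; ∣_∣; 0ℤ; 1ℤ; ≢-nonZero)
open import Data.Integer.Properties as ℤ using (+-identityʳ; +-identityˡ; +-assoc)
open import Data.Integer.Tactic.RingSolver using (solve-∀)
open import Data.Fin using (toℕ)
open import Data.Fin.Properties using (pigeonhole; toℕ-injective; <-irrefl)
open import Data.List using (List; []; map; length; lookup)
open import Data.List.Membership.Propositional using (_∈_; _∉_)
open import Data.List.Membership.Propositional.Properties using (∈-map⁺)
open import Data.List.Relation.Unary.Any using (index)
open import Data.List.Relation.Unary.Any.Properties using (lookup-index)
open import Data.Product using (_,_; proj₁; proj₂)
import Data.Product as ×
open import Data.Sum using (_⊎_; inj₁; inj₂)
import Data.Sum as Sum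
open import Data.Empty using (⊥-elim)
open import Function using (_∘_)
open import Function.Bundles using (_⇔_; mk⇔; Equivalence)
open import Function.Definitions using (Injective)
open import Relation.Binary.Definitions using (Symmetric)
open import Relation.Nullary using (¬_; yes; no)
open import Relation.Binary.PropositionalEquality
  using (_≢_; refl; sym; trans; cong; subst; subst₂; module ≡-Reasoning)

open Equivalence using () renaming (to to ⇒; from to ⇐)

module ℤ-Arithmetic where

  +-cancelˡ-≡ : ∀ k {i j} → k + i ≡ k + j → i ≡ j
  +-cancelˡ-≡ k {i} {j} eq = trans (sym ([k+i]-k≡i k i)) (trans (cong (_- k) eq) ([k+i]-k≡i k j))
    where
    [k+i]-k≡i : ∀ k i → k + i - k ≡ i
    [k+i]-k≡i = solve-∀

  [i+1]+1≢i : ∀ i → i + 1ℤ + 1ℤ ≢ i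
  [i+1]+1≢i i eq with +-cancelˡ-≡ i (trans (sym (+-assoc i 1ℤ 1ℤ)) (trans eq (sym (+-identityʳ i))))
  ... | ()

  [i-1]+1≡i : ∀ i → i - 1ℤ + 1ℤ ≡ i
  [i-1]+1≡i = solve-∀

  [i+1]-1≡i : ∀ i → i + 1ℤ - 1ℤ ≡ i
  [i+1]-1≡i = solve-∀

  [i-c]+c≡i : ∀ i c → i - c + c ≡ i
  [i-c]+c≡i = solve-∀

  [i+x]+c≡[i+c]+x : ∀ i x c → i + x + c ≡ i + c + x
  [i+x]+c≡[i+c]+x = solve-∀

  [c-j]+1≡c-[j-1] : ∀ c j → c - j + 1ℤ ≡ c - (j - 1ℤ)
  [c-j]+1≡c-[j-1] = solve-∀

  [c-j]-1≡c-[j+1] : ∀ c j → c - j - 1ℤ ≡ c - (j + 1ℤ)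
  [c-j]-1≡c-[j+1] = solve-∀

  c-[c-i]≡i : ∀ c i → c - (c - i) ≡ i
  c-[c-i]≡i = solve-∀

  [a-i]+b≡[a+b]-i : ∀ a i b → a - i + b ≡ a + b - i
  [a-i]+b≡[a+b]-i = solve-∀

  b-[a-i]≡i+[b-a] : ∀ a b i → b - (a - i) ≡ i + (b - a)
  b-[a-i]≡i+[b-a] = solve-∀

  [-c+s]+c≡s : ∀ c s → - c + s + c ≡ s
  [-c+s]+c≡s = solve-∀

  c-[c+s]≡-s : ∀ c s → c - (c + s) ≡ - s
  c-[c+s]≡-s = solve-∀

  [-a]*c+c*a≡0 : ∀ a c → (- a) * c + c * a ≡ 0ℤ
  [-a]*c+c*a≡0 = solve-∀

  [-a]*e+c*b≡0⇒a*e≡b*c : ∀ a b c e → (- a) * e + c * b ≡ 0ℤ → a * e ≡ b * c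
  [-a]*e+c*b≡0⇒a*e≡b*c a b c e eq = begin
    a * e                          ≡⟨ rearrange a b c e ⟩
    b * c - ((- a) * e + c * b)    ≡⟨ cong (λ x → b * c - x) eq ⟩
    b * c - 0ℤ                     ≡⟨ +-identityʳ (b * c) ⟩
    b * c                          ∎
    where
    open ≡-Reasoning
    rearrange : ∀ a b c e → a * e ≡ b * c - ((- a) * e + c * b)
    rearrange = solve-∀

  m*m≡4⇒m≡2 : ∀ m → m ℕ.* m ≡ 4 → m ≡ 2
  m*m≡4⇒m≡2 0 ()
  m*m≡4⇒m≡2 1 ()
  m*m≡4⇒m≡2 2 _ = refl
  m*m≡4⇒m≡2 (suc (suc (suc k))) eq with subst (9 ℕ.≤_) eq (ℕ.*-mono-≤ (ℕ.m≤m+n 3 k) (ℕ.m≤m+n 3 k))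
  ... | s≤s (s≤s (s≤s (s≤s ())))

  ∣i∣≡2⇒i≡±2 : ∀ i → ∣ i ∣ ≡ 2 → i ≡ + 2 ⊎ i ≡ - + 2
  ∣i∣≡2⇒i≡±2 (+ n) eq = inj₁ (cong +_ eq)
  ∣i∣≡2⇒i≡±2 -[1+ n ] eq with ℕ.suc-injective eq
  ... | refl = inj₂ refl

  ∣±i∣≡∣i∣ : ∀ i j → j ≡ i ⊎ j ≡ - i → ∣ j ∣ ≡ ∣ i ∣
  ∣±i∣≡∣i∣ i j (inj₁ refl) = refl
  ∣±i∣≡∣i∣ i j (inj₂ refl) = ℤ.∣-i∣≡∣i∣ i

  t≡±2 : ∀ t u v → u ≡ t ⊎ u ≡ - t → v ≡ + 2 ⊎ v ≡ - + 2 → + 2 * v ≡ t * u →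
    t ≡ + 2 ⊎ t ≡ - + 2
  t≡±2 t u v u≡±t v≡±2 eq = ∣i∣≡2⇒i≡±2 t (m*m≡4⇒m≡2 ∣ t ∣ (begin
    ∣ t ∣ ℕ.* ∣ t ∣   ≡⟨ cong (ℕ._*_ ∣ t ∣) (∣±i∣≡∣i∣ t u u≡±t) ⟨
    ∣ t ∣ ℕ.* ∣ u ∣   ≡⟨ ℤ.abs-* t u ⟨
    ∣ t * u ∣         ≡⟨ cong ∣_∣ eq ⟨
    ∣ + 2 * v ∣       ≡⟨ ℤ.abs-* (+ 2) v ⟩
    2 ℕ.* ∣ v ∣       ≡⟨ cong (ℕ._*_ 2) (∣±i∣≡∣i∣ (+ 2) v v≡±2) ⟩
    4                 ∎))
    where open ≡-Reasoning

open ℤ-Arithmetic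

ℤ-induction : (P : ℤ → Set) → P 0ℤ → (∀ i → P i → P (i + 1ℤ)) → (∀ i → P i → P (i - 1ℤ)) →
  ∀ i → P i
ℤ-induction P p₀ up down (+ zero) = p₀
ℤ-induction P p₀ up down (+ suc n) =
  subst P (cong +_ (ℕ.+-comm n 1)) (up (+ n) (ℤ-induction P p₀ up down (+ n)))
ℤ-induction P p₀ up down -[1+ zero ] = down 0ℤ p₀
ℤ-induction P p₀ up down -[1+ suc n ] =
  subst P (cong (λ m → -[1+ suc m ]) (ℕ.+-identityʳ n))
    (down -[1+ n ] (ℤ-induction P p₀ up down -[1+ n ]))

¬all∈-of-injective : ∀ {A : Set} (l : List A) (h : ℕ → A) → Injective _≡_ _≡_ h →
  ¬ (∀ n → h n ∈ l)
¬all∈-of-injective l h inj h∈l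
  with i , j , i<j , same-index ← pigeonhole (ℕ.n<1+n (length l)) (index ∘ h∈l ∘ toℕ)
  = <-irrefl (toℕ-injective (inj (begin
      h (toℕ i)                       ≡⟨ lookup-index (h∈l (toℕ i)) ⟩
      lookup l (index (h∈l (toℕ i)))  ≡⟨ cong (lookup l) same-index ⟩
      lookup l (index (h∈l (toℕ j)))  ≡⟨ lookup-index (h∈l (toℕ j)) ⟨
      h (toℕ j)                       ∎))) i<j
  where open ≡-Reasoning

module Paths {V : Set} (R : V → V → Set) where

  IsPath : (ℤ → V) → Set
  IsPath e = ∀ i → R (e i) (e (i + 1ℤ))

  NeighboursOnPath : (ℤ → V) → Set
  NeighboursOnPath d = ∀ j w → R (d j) w → w ≡ d (j + 1ℤ) ⊎ w ≡ d (j - 1ℤ)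

  NeighboursOnPath-shift : ∀ {d} c → NeighboursOnPath d → NeighboursOnPath (λ i → d (i + c))
  NeighboursOnPath-shift {d} c nbrs j w r =
    Sum.map (λ eq → trans eq (cong d ([i+x]+c≡[i+c]+x j c 1ℤ)))
            (λ eq → trans eq (cong d ([i+x]+c≡[i+c]+x j c (- 1ℤ))))
            (nbrs (j + c) w r)

  NeighboursOnPath-flip : ∀ {d} c → NeighboursOnPath d → NeighboursOnPath (λ i → d (c - i))
  NeighboursOnPath-flip {d} c nbrs j w r =
    Sum.swap (Sum.map (λ eq → trans eq (cong d ([c-j]+1≡c-[j-1] c j)))
                      (λ eq → trans eq (cong d ([c-j]-1≡c-[j+1] c j)))
                      (nbrs (c - j) w r))

  -- An injective path that starts like e′ must follow e′: at each vertex of e′ the only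
  -- way on is forward, since going back would revisit a vertex.
  paths-agree : ∀ {e e′} → Symmetric R → Injective _≡_ _≡_ e → IsPath e → NeighboursOnPath e′ →
    e 0ℤ ≡ e′ 0ℤ → e 1ℤ ≡ e′ 1ℤ → ∀ i → e i ≡ e′ i
  paths-agree {e} {e′} R-sym inj path nbrs e₀ e₁ i =
    proj₁ (ℤ-induction Agree (e₀ , e₁) up down i)
    where
    Agree : ℤ → Set
    Agree i = e i ≡ e′ i × e (i + 1ℤ) ≡ e′ (i + 1ℤ)

    up : ∀ i → Agree i → Agree (i + 1ℤ)
    up i (eᵢ , eᵢ₊₁)
      with nbrs (i + 1ℤ) (e (i + 1ℤ + 1ℤ))
                (subst (λ v → R v (e (i + 1ℤ + 1ℤ))) eᵢ₊₁ (path (i + 1ℤ)))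
    ... | inj₁ forward = eᵢ₊₁ , forward
    ... | inj₂ back =
      ⊥-elim ([i+1]+1≢i i (inj (trans back (trans (cong e′ ([i+1]-1≡i i)) (sym eᵢ)))))

    down : ∀ i → Agree i → Agree (i - 1ℤ)
    down i (eᵢ , eᵢ₊₁)
      with nbrs i (e (i - 1ℤ)) (subst (λ v → R v (e (i - 1ℤ))) eᵢ
                 (R-sym (subst (R (e (i - 1ℤ)) ∘ e) ([i-1]+1≡i i) (path (i - 1ℤ)))))
    ... | inj₁ forward = ⊥-elim ([i+1]+1≢i (i - 1ℤ)
      (inj (trans (cong (λ j → e (j + 1ℤ)) ([i-1]+1≡i i)) (trans eᵢ₊₁ (sym forward)))))
    ... | inj₂ back = back , trans (cong e ([i-1]+1≡i i)) (trans eᵢ (cong e′ (sym ([i-1]+1≡i i))))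

  path-along : ∀ {e d} c → Symmetric R → Injective _≡_ _≡_ e → IsPath e → NeighboursOnPath d →
    e 0ℤ ≡ d c → (∀ i → e i ≡ d (i + c)) ⊎ (∀ i → e i ≡ d (c - i))
  path-along {e} {d} c R-sym inj path nbrs e₀ with nbrs c (e 1ℤ) (subst (λ v → R v _) e₀ (path 0ℤ))
  ... | inj₁ e₁ = inj₁ (paths-agree R-sym inj path (NeighboursOnPath-shift c nbrs)
                          (trans e₀ (cong d (sym (+-identityˡ c))))
                          (trans e₁ (cong d (ℤ.+-comm c 1ℤ))))
  ... | inj₂ e₁ = inj₂ (paths-agree R-sym inj path (NeighboursOnPath-flip c nbrs)
                          (trans e₀ (cong d (sym (+-identityʳ c)))) e₁)

module Automorphisms (X : Graph) where
  open Graph X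
  open GraphNotions X
  open Aut

  to-injective : (g : Aut) → Injective _≡_ _≡_ (to g)
  to-injective g {u} {v} eq = trans (sym (from-to g u)) (trans (cong (from g) eq) (from-to g v))

  to-adj : (g : Aut) → ∀ {u v} → u ~ v → to g u ~ to g v
  to-adj g {u} {v} = ⇒ (adj g u v)

  from-adj : (g : Aut) → ∀ {u v} → u ~ v → from g u ~ from g v
  from-adj g {u} {v} p =
    ⇐ (adj g (from g u) (from g v)) (subst₂ _~_ (sym (to-from g u)) (sym (to-from g v)) p)

  idᴬ : Aut
  idᴬ = record { to = λ v → v ; from = λ v → v ; to-from = λ _ → refl ; from-to = λ _ → refl
               ; adj = λ _ _ → mk⇔ (λ p → p) (λ p → p) }

  infixr 9 _∘ᴬ_
  _∘ᴬ_ : Aut → Aut → Aut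
  g ∘ᴬ h = record
    { to = to g ∘ to h
    ; from = from h ∘ from g
    ; to-from = λ v → trans (cong (to g) (to-from h (from g v))) (to-from g v)
    ; from-to = λ v → trans (cong (from h) (from-to g (to h v))) (from-to h v)
    ; adj = λ u v → mk⇔ (to-adj g ∘ to-adj h) (⇐ (adj h u v) ∘ ⇐ (adj g (to h u) (to h v)))
    }

  _⁻¹ᴬ : Aut → Aut
  g ⁻¹ᴬ = record
    { to = from g ; from = to g ; to-from = from-to g ; from-to = to-from g
    ; adj = λ u v → mk⇔ (from-adj g) (subst₂ _~_ (to-from g u) (to-from g v) ∘ to-adj g)
    }

  _^ℕ_ : Aut → ℕ → Aut
  g ^ℕ zero = idᴬ
  g ^ℕ suc n = (g ^ℕ n) ∘ᴬ g

  _^_ : Aut → ℤ → Aut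
  g ^ (+ n) = g ^ℕ n
  g ^ -[1+ n ] = (g ⁻¹ᴬ) ^ℕ suc n

  ∉-from : (g : Aut) → ∀ {u K} → u ∉ map (to g) K → from g u ∉ K
  ∉-from g {u} u∉gK = u∉gK ∘ subst (_∈ _) (to-from g u) ∘ ∈-map⁺ (to g)

  Reach-from : (g : Aut) → ∀ {K a b} → Reach (map (to g) K) a b → Reach K (from g a) (from g b)
  Reach-from g (here a∉gK) = here (∉-from g a∉gK)
  Reach-from g (step a∉gK a~w w⇝b) = step (∉-from g a∉gK) (from-adj g a~w) (Reach-from g w⇝b)

  SameEnd-image⁻ : (g : Aut) → ∀ r s → SameEnd (to g ∘ r) (to g ∘ s) → SameEnd r s
  SameEnd-image⁻ g r s same K with m , n , r-tail , s-tail , r⇝s ← same (map (to g) K) =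
    m , n , (λ k → r-tail k ∘ ∈-map⁺ (to g)) , (λ k → s-tail k ∘ ∈-map⁺ (to g)) ,
    subst₂ (Reach K) (from-to g (r m)) (from-to g (s n)) (Reach-from g r⇝s)

  EdgeOf-image : (g : Aut) → ∀ d u v → EdgeOf d (from g u) (from g v) ⇔ EdgeOf (to g ∘ d) u v
  EdgeOf-image g d u v = mk⇔
    (λ (i , eq) → i , Sum.map (×.map to-side to-side) (×.map to-side to-side) eq)
    (λ (i , eq) → i , Sum.map (×.map from-side from-side) (×.map from-side from-side) eq)
    where
    to-side : ∀ {w a} → from g w ≡ a → w ≡ to g a
    to-side {w} eq = trans (sym (to-from g w)) (cong (to g) eq)
    from-side : ∀ {w a} → w ≡ to g a → from g w ≡ a
    from-side {a = a} eq = trans (cong (from g) eq) (from-to g a)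

  IsDoubleRay-image : (g : Aut) → ∀ {d} → IsDoubleRay d → IsDoubleRay (to g ∘ d)
  IsDoubleRay-image g (inj , adj-d) = (λ i j → inj i j ∘ to-injective g) , (to-adj g ∘ adj-d)

  IsHamDecomp-image : (g : Aut) → ∀ {H d₁ d₂} → IsHamDecomp H d₁ d₂ →
    IsHamDecomp (λ u v → H (from g u) (from g v)) (to g ∘ d₁) (to g ∘ d₂)
  IsHamDecomp-image g {d₁ = d₁} {d₂} (ray₁ , ray₂ , disjoint , cover , ends₁ , ends₂ , edges) =
    IsDoubleRay-image g ray₁ , IsDoubleRay-image g ray₂ ,
    (λ i j → disjoint i j ∘ to-injective g) ,
    (λ v → Sum.map (on-image v {d₁}) (on-image v {d₂}) (cover (from g v))) ,
    ends₁ ∘ SameEnd-image⁻ g _ _ , ends₂ ∘ SameEnd-image⁻ g _ _ ,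
    λ u v → mk⇔
      (Sum.map (⇒ (EdgeOf-image g d₁ u v)) (⇒ (EdgeOf-image g d₂ u v)) ∘ ⇒ (edges _ _))
      (⇐ (edges _ _) ∘ Sum.map (⇐ (EdgeOf-image g d₁ u v)) (⇐ (EdgeOf-image g d₂ u v)))
    where
    on-image : ∀ v {d} → ∃[ i ] from g v ≡ d i → ∃[ i ] v ≡ to g (d i)
    on-image v (i , eq) = i , trans (sym (to-from g v)) (cong (to g) eq)

  UniqueHamCircle-invariant : ∀ {C} → UniqueHamCircle C → (g : Aut) → ∀ {u v} →
    C u v → C (to g u) (to g v)
  UniqueHamCircle-invariant {C} ((_ , _ , hd) , unique) g {u} {v} c =
    ⇐ (unique _ (_ , _ , IsHamDecomp-image g hd) (to g u) (to g v))
      (subst₂ C (sym (from-to g u)) (sym (from-to g v)) c)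

module ShiftsAndFlips (X : Graph) where
  open Graph X
  open GraphNotions X
  open Aut
  open Automorphisms X

  record Shifts (g : Aut) (d d′ : ℤ → V) (c : ℤ) : Set where
    constructor shifting
    field shift-at : ∀ i → to g (d i) ≡ d′ (i + c)

  record Flips (g : Aut) (d d′ : ℤ → V) (c : ℤ) : Set where
    constructor flipping
    field flip-at : ∀ i → to g (d i) ≡ d′ (c - i)

  open Shifts public
  open Flips public

  shifts-cong : ∀ {g d d′ c c′} → c ≡ c′ → Shifts g d d′ c → Shifts g d d′ c′
  shifts-cong refl g-shifts = g-shifts

  shifts-id : ∀ {d} → Shifts idᴬ d d 0ℤ
  shifts-id {d} = shifting λ i → cong d (sym (+-identityʳ i))

  shifts-∘ : ∀ {g h d₁ d₂ d₃ a b} → Shifts g d₂ d₃ b → Shifts h d₁ d₂ a →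
    Shifts (g ∘ᴬ h) d₁ d₃ (a + b)
  shifts-∘ {g} {d₃ = d₃} {a} {b} g-shifts h-shifts = shifting λ i →
    trans (cong (to g) (h-shifts .shift-at i))
      (trans (g-shifts .shift-at (i + a)) (cong d₃ (+-assoc i a b)))

  shifts-∘-flips : ∀ {g h d₁ d₂ d₃ a b} → Shifts g d₂ d₃ b → Flips h d₁ d₂ a →
    Flips (g ∘ᴬ h) d₁ d₃ (a + b)
  shifts-∘-flips {g} {d₃ = d₃} {a} {b} g-shifts h-flips = flipping λ i →
    trans (cong (to g) (h-flips .flip-at i))
      (trans (g-shifts .shift-at (a - i)) (cong d₃ ([a-i]+b≡[a+b]-i a i b)))

  flips-∘-flips : ∀ {g h d₁ d₂ d₃ a b} → Flips g d₂ d₃ b → Flips h d₁ d₂ a →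
    Shifts (g ∘ᴬ h) d₁ d₃ (b - a)
  flips-∘-flips {g} {d₃ = d₃} {a} {b} g-flips h-flips = shifting λ i →
    trans (cong (to g) (h-flips .flip-at i))
      (trans (g-flips .flip-at (a - i)) (cong d₃ (b-[a-i]≡i+[b-a] a b i)))

  shifts-⁻¹ : ∀ {g d d′ c} → Shifts g d d′ c → Shifts (g ⁻¹ᴬ) d′ d (- c)
  shifts-⁻¹ {g} {d} {d′} {c} g-shifts = shifting λ i → begin
    from g (d′ i)                 ≡⟨ cong (from g ∘ d′) ([i-c]+c≡i i c) ⟨
    from g (d′ (i - c + c))       ≡⟨ cong (from g) (g-shifts .shift-at (i - c)) ⟨
    from g (to g (d (i - c)))     ≡⟨ from-to g _ ⟩
    d (i - c)                     ∎
    where open ≡-Reasoning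

  flips-⁻¹ : ∀ {g d d′ c} → Flips g d d′ c → Flips (g ⁻¹ᴬ) d′ d c
  flips-⁻¹ {g} {d} {d′} {c} g-flips = flipping λ i → begin
    from g (d′ i)                 ≡⟨ cong (from g ∘ d′) (c-[c-i]≡i c i) ⟨
    from g (d′ (c - (c - i)))     ≡⟨ cong (from g) (g-flips .flip-at (c - i)) ⟨
    from g (to g (d (c - i)))     ≡⟨ from-to g _ ⟩
    d (c - i)                     ∎
    where open ≡-Reasoning

  shifts-^ℕ : ∀ {g d a} → Shifts g d d a → ∀ n → Shifts (g ^ℕ n) d d (+ n * a)
  shifts-^ℕ g-shifts zero = shifts-id
  shifts-^ℕ {a = a} g-shifts (suc n) =
    shifts-cong (sym (ℤ.suc-* (+ n) a)) (shifts-∘ (shifts-^ℕ g-shifts n) g-shifts)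

  shifts-^ : ∀ {g d a} → Shifts g d d a → ∀ z → Shifts (g ^ z) d d (z * a)
  shifts-^ g-shifts (+ n) = shifts-^ℕ g-shifts n
  shifts-^ {a = a} g-shifts -[1+ n ] =
    shifts-cong (trans (sym (ℤ.neg-distribʳ-* (+ suc n) a)) (ℤ.neg-distribˡ-* (+ suc n) a))
      (shifts-^ℕ (shifts-⁻¹ g-shifts) (suc n))

  conjugate-shifts : ∀ {f h d d′ c s} → Shifts f d′ d′ s → Shifts h d′ d c ⊎ Flips h d′ d c →
    ∃[ s′ ] (s′ ≡ s ⊎ s′ ≡ - s) × Shifts (h ∘ᴬ f ∘ᴬ h ⁻¹ᴬ) d d s′
  conjugate-shifts {c = c} {s} f-shifts (inj₁ h-shifts) = s , inj₁ refl ,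
    shifts-cong ([-c+s]+c≡s c s) (shifts-∘ h-shifts (shifts-∘ f-shifts (shifts-⁻¹ h-shifts)))
  conjugate-shifts {c = c} {s} f-shifts (inj₂ h-flips) = - s , inj₂ refl ,
    shifts-cong (c-[c+s]≡-s c s)
      (flips-∘-flips h-flips (shifts-∘-flips f-shifts (flips-⁻¹ h-flips)))

  preimage-on-path : ∀ {g d d′ c} → Shifts g d d′ c ⊎ Flips g d d′ c →
    ∀ k → ∃[ i ] from g (d′ k) ≡ d i
  preimage-on-path (inj₁ g-shifts) k = _ , shifts-⁻¹ g-shifts .shift-at k
  preimage-on-path (inj₂ g-flips) k = _ , flips-⁻¹ g-flips .flip-at k

  image-avoids-image : ∀ {g} {d d′ e : ℤ → V} {c} → Shifts g d d′ c ⊎ Flips g d d′ c →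
    (∀ i j → d i ≢ e j) → ∀ j k → to g (e j) ≢ d′ k
  image-avoids-image {g} {d} {d′} {e} g-maps disjoint j k eq
    with i , d′ₖ↦dᵢ ← preimage-on-path g-maps k = disjoint i j (begin
      d i                  ≡⟨ d′ₖ↦dᵢ ⟨
      from g (d′ k)        ≡⟨ cong (from g) eq ⟨
      from g (to g (e j))  ≡⟨ from-to g (e j) ⟩
      e j                  ∎)
    where open ≡-Reasoning

  -- Were b ≠ 0, the vertex d p would be adjacent to all the distinct vertices d′ (q + n b).
  shift≡0-beside-fixed-path : LocallyFinite → ∀ {g d d′ b p q} → Injective _≡_ _≡_ d′ →
    d p ~ d′ q → Shifts g d d 0ℤ → Shifts g d′ d′ b → b ≡ 0ℤ
  shift≡0-beside-fixed-path lf {g} {d} {d′} {b} {p} {q} inj edge fixes shifts with b ℤ.≟ 0ℤ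
  ... | yes b≡0 = b≡0
  ... | no b≢0 =
    ⊥-elim (¬all∈-of-injective (proj₁ (lf (d p))) orbit orbit-injective
      λ n → proj₂ (lf (d p)) _ (edgeₙ n))
    where
    orbit : ℕ → V
    orbit n = d′ (q + + n * b)
    orbit-injective : Injective _≡_ _≡_ orbit
    orbit-injective eq =
      ℤ.+-injective (ℤ.*-cancelʳ-≡ _ _ b {{≢-nonZero b≢0}} (+-cancelˡ-≡ q (inj eq)))
    edgeₙ : ∀ n → d p ~ orbit n
    edgeₙ n = subst₂ _~_
      (trans (shifts-^ℕ fixes n .shift-at p)
        (cong d (trans (cong (_+_ p) (ℤ.*-zeroʳ (+ n))) (+-identityʳ p))))
      (shifts-^ℕ shifts n .shift-at q) (to-adj (g ^ℕ n) edge)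

  -- The automorphism g^c k^(−a) fixes d, so it cannot shift d′.
  shift-ratios-agree : LocallyFinite → ∀ {g k d d′ a b c e p q} → Injective _≡_ _≡_ d′ →
    d p ~ d′ q → Shifts g d d a → Shifts g d′ d′ b → Shifts k d d c → Shifts k d′ d′ e →
    a * e ≡ b * c
  shift-ratios-agree lf {a = a} {b} {c} {e} inj edge g-d g-d′ k-d k-d′ =
    [-a]*e+c*b≡0⇒a*e≡b*c a b c e (shift≡0-beside-fixed-path lf inj edge
      (shifts-cong ([-a]*c+c*a≡0 a c) (shifts-∘ (shifts-^ g-d c) (shifts-^ k-d (- a))))
      (shifts-∘ (shifts-^ g-d′ c) (shifts-^ k-d′ (- a))))

module HamiltonianDecompositions (X : Graph) where
  open Graph X
  open GraphNotions X
  open Paths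

  EdgeOf-neighbours : ∀ {d j w} → (∀ i k → d i ≡ d k → i ≡ k) → EdgeOf d (d j) w →
    w ≡ d (j + 1ℤ) ⊎ w ≡ d (j - 1ℤ)
  EdgeOf-neighbours {j = j} injective (k , inj₁ (eq , w≡)) with injective j k eq
  ... | refl = inj₁ w≡
  EdgeOf-neighbours {d} {j} injective (k , inj₂ (w≡ , eq)) with injective j (k + 1ℤ) eq
  ... | refl = inj₂ (trans w≡ (cong d (sym ([i+1]-1≡i k))))

  module _ {H : V → V → Set} {d₁ d₂ : ℤ → V} where

    IsHamDecomp-swap : IsHamDecomp H d₁ d₂ → IsHamDecomp H d₂ d₁
    IsHamDecomp-swap (ray₁ , ray₂ , disjoint , cover , ends₁ , ends₂ , edges) =
      ray₂ , ray₁ , (λ i j → disjoint j i ∘ sym) , Sum.swap ∘ cover , ends₂ , ends₁ ,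
      λ u v → mk⇔ (Sum.swap ∘ ⇒ (edges u v)) (⇐ (edges u v) ∘ Sum.swap)

    IsHamDecomp-injective₁ : IsHamDecomp H d₁ d₂ → Injective _≡_ _≡_ d₁
    IsHamDecomp-injective₁ ((injective , _) , _) = injective _ _

    IsHamDecomp-symmetric : IsHamDecomp H d₁ d₂ → Symmetric H
    IsHamDecomp-symmetric (_ , _ , _ , _ , _ , _ , edges) {u} {v} =
      ⇐ (edges v u) ∘ Sum.map EdgeOf-sym EdgeOf-sym ∘ ⇒ (edges u v)
      where
      EdgeOf-sym : ∀ {d} → EdgeOf d u v → EdgeOf d v u
      EdgeOf-sym (i , eq) = i , Sum.swap eq

    IsHamDecomp-path₁ : IsHamDecomp H d₁ d₂ → IsPath H d₁
    IsHamDecomp-path₁ (_ , _ , _ , _ , _ , _ , edges) i =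
      ⇐ (edges _ _) (inj₁ (i , inj₁ (refl , refl)))

    IsHamDecomp-neighbours₁ : IsHamDecomp H d₁ d₂ → NeighboursOnPath H d₁
    IsHamDecomp-neighbours₁ ((injective , _) , _ , disjoint , _ , _ , _ , edges) j w h
      with ⇒ (edges _ _) h
    ... | inj₁ edge = EdgeOf-neighbours injective edge
    ... | inj₂ (k , inj₁ (eq , _)) = ⊥-elim (disjoint j k eq)
    ... | inj₂ (k , inj₂ (_ , eq)) = ⊥-elim (disjoint j (k + 1ℤ) eq)

    crossing-edge : Connected → IsHamDecomp H d₁ d₂ → ∃[ p ] ∃[ q ] d₁ p ~ d₂ q
    crossing-edge connected (_ , _ , disjoint , cover , _) =
      walk (connected (d₁ 0ℤ) (d₂ 0ℤ)) (0ℤ , refl)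
      where
      walk : ∀ {u} → Reach [] u (d₂ 0ℤ) → ∃[ i ] u ≡ d₁ i → ∃[ p ] ∃[ q ] d₁ p ~ d₂ q
      walk (here _) (i , eq) = ⊥-elim (disjoint i 0ℤ (sym eq))
      walk (step {w = w} _ u~w w⇝) (i , eq) with cover w
      ... | inj₁ on-d₁ = walk w⇝ on-d₁
      ... | inj₂ (j , w≡) = i , j , subst₂ _~_ eq w≡ u~w

  Relabels-refl : ∀ d → Relabels d d
  Relabels-refl d = 0ℤ , inj₁ λ i → cong d (sym (+-identityˡ i))

  Relabels-reverse : ∀ d → Relabels d (d ∘ -_)
  Relabels-reverse d = 0ℤ , inj₂ λ i → cong d (sym (+-identityˡ (- i)))

module UniqueCircle (X : Graph) (C : Graph.V X → Graph.V X → Set)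
    (unique : GraphNotions.UniqueHamCircle X C) (P₁ P₂ : ℤ → Graph.V X)
    (hd : GraphNotions.IsHamDecomp X C P₁ P₂) where
  open Graph X
  open GraphNotions X
  open Aut
  open Automorphisms X
  open ShiftsAndFlips X
  open HamiltonianDecompositions X
  open Paths C

  private
    hd′ = IsHamDecomp-swap hd
    disjoint = proj₁ (proj₂ (proj₂ hd))
    cover = proj₁ (proj₂ (proj₂ (proj₂ hd)))
    P₁-injective = IsHamDecomp-injective₁ hd
    P₂-injective = IsHamDecomp-injective₁ hd′
    P₁-neighbours = IsHamDecomp-neighbours₁ hd
    P₂-neighbours = IsHamDecomp-neighbours₁ hd′

  maps-path : (g : Aut) → ∀ {d d′} c → IsPath d → Injective _≡_ _≡_ d → NeighboursOnPath d′ →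
    to g (d 0ℤ) ≡ d′ c → Shifts g d d′ c ⊎ Flips g d d′ c
  maps-path g c path injective nbrs g₀ = Sum.map shifting flipping
    (path-along c (IsHamDecomp-symmetric hd) (injective ∘ to-injective g)
      (UniqueHamCircle-invariant unique g ∘ path) nbrs g₀)

  maps-P₁ : (g : Aut) → ∀ {d′ c} → NeighboursOnPath d′ → to g (P₁ 0ℤ) ≡ d′ c →
    Shifts g P₁ d′ c ⊎ Flips g P₁ d′ c
  maps-P₁ g = maps-path g _ (IsHamDecomp-path₁ hd) P₁-injective

  maps-P₂ : (g : Aut) → ∀ {d′ c} → NeighboursOnPath d′ → to g (P₂ 0ℤ) ≡ d′ c →
    Shifts g P₂ d′ c ⊎ Flips g P₂ d′ c
  maps-P₂ g = maps-path g _ (IsHamDecomp-path₁ hd′) P₂-injective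

  shift-P₁-by-2 : VertexTransitive → Σ Aut λ f → Shifts f P₁ P₁ (+ 2)
  shift-P₁-by-2 vt with g , g₀ ← vt (P₁ 0ℤ) (P₁ 1ℤ) | h , h₀ ← vt (P₁ 0ℤ) (P₁ (+ 2))
    with maps-P₁ g P₁-neighbours g₀ | maps-P₁ h P₁-neighbours h₀
  ... | inj₁ g-shifts | _ = g ∘ᴬ g , shifts-∘ g-shifts g-shifts
  ... | inj₂ _ | inj₁ h-shifts = h , h-shifts
  ... | inj₂ g-flips | inj₂ h-flips = (h ∘ᴬ g) ∘ᴬ (h ∘ᴬ g) , shifts-∘ hg-shifts hg-shifts
    where hg-shifts = flips-∘-flips h-flips g-flips

  shift-on-P₂ : LocallyFinite → Connected → ∀ {f} → Shifts f P₁ P₁ (+ 2) → ∃[ t ] Shifts f P₂ P₂ t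
  shift-on-P₂ lf connected {f} f-P₁ with cover (to f (P₂ 0ℤ))
  ... | inj₁ (k , eq) = ⊥-elim (image-avoids-image (inj₁ f-P₁) disjoint 0ℤ k eq)
  ... | inj₂ (t , eq) with maps-P₂ f P₂-neighbours eq
  ...   | inj₁ f-P₂ = t , f-P₂
  ...   | inj₂ f-flips with p , q , edge ← crossing-edge connected hd =
    ⊥-elim (4≢0 (shift≡0-beside-fixed-path lf P₁-injective (~-sym edge)
      (shifts-cong (ℤ.+-inverseʳ t) (flips-∘-flips f-flips f-flips)) (shifts-∘ f-P₁ f-P₁)))
    where
    4≢0 : + 4 ≢ 0ℤ
    4≢0 ()

  shift-on-P₂≡±2 : LocallyFinite → Connected → VertexTransitive → ∀ {f t} →
    Shifts f P₁ P₁ (+ 2) → Shifts f P₂ P₂ t → t ≡ + 2 ⊎ t ≡ - + 2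
  shift-on-P₂≡±2 lf connected vt {t = t} f-P₁ f-P₂
    with h , h₀ ← vt (P₁ 0ℤ) (P₂ 0ℤ)
    with h-P₁ ← maps-P₁ h P₂-neighbours h₀
    with cover (to h (P₂ 0ℤ))
  ... | inj₂ (k , eq) = ⊥-elim (image-avoids-image h-P₁ disjoint 0ℤ k eq)
  ... | inj₁ (_ , eq)
    with c , c≡±t , k-P₁ ← conjugate-shifts f-P₂ (maps-P₂ h P₁-neighbours eq)
       | e , e≡±2 , k-P₂ ← conjugate-shifts f-P₁ h-P₁
       | p , q , edge ← crossing-edge connected hd
    = t≡±2 t c e c≡±t e≡±2 (shift-ratios-agree lf P₂-injective edge f-P₁ f-P₂ k-P₁ k-P₂)

  g₂-labelling : ∀ {f t} → Shifts f P₁ P₁ (+ 2) → Shifts f P₂ P₂ t → t ≡ + 2 ⊎ t ≡ - + 2 →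
    ∃[ x ] ∃[ y ] (Relabels P₁ x × Relabels P₂ y ×
      (∀ i → to f (x i) ≡ x (i + + 2)) × (∀ i → to f (y i) ≡ y (i + + 2)))
  g₂-labelling f-P₁ f-P₂ (inj₁ refl) =
    P₁ , P₂ , Relabels-refl P₁ , Relabels-refl P₂ , f-P₁ .shift-at , f-P₂ .shift-at
  g₂-labelling f-P₁ f-P₂ (inj₂ refl) =
    P₁ , P₂ ∘ -_ , Relabels-refl P₁ , Relabels-reverse P₂ , f-P₁ .shift-at ,
    λ i → trans (f-P₂ .shift-at (- i)) (cong P₂ (sym (ℤ.neg-distrib-+ i (+ 2))))

lemma3p3 : (X : Graph) → let open Graph X in let open GraphNotions X in
    Connected → LocallyFinite → VertexTransitive → TwoEnded →
    (C : V → V → Set) → UniqueHamCircle C →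
    (P₁ P₂ : ℤ → V) → IsHamDecomp C P₁ P₂ →
    Σ Aut (λ g₂ → ∃[ x ] ∃[ y ] (Relabels P₁ x × Relabels P₂ y ×
    (∀ i → Aut.to g₂ (x i) ≡ x (i + + 2)) ×
    (∀ i → Aut.to g₂ (y i) ≡ y (i + + 2))))
lemma3p3 X connected lf vt _ C unique P₁ P₂ hd =
  let f , f-P₁ = shift-P₁-by-2 vt
      _ , f-P₂ = shift-on-P₂ lf connected f-P₁
  in  f , g₂-labelling f-P₁ f-P₂ (shift-on-P₂≡±2 lf connected vt f-P₁ f-P₂)
  where open UniqueCircle X C unique P₁ P₂ hd
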